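{- Let $N\ge1$ and $n=\lfloor\log_2(N+1)\rfloor$. For every $0\le i\le n-2$, \[f_i(N)-f_{i+1}(N)=\sum_{j=i+1}^{n-1}2^{\,j-i-1}c_j(N).\]
   Context: Unlabeled chip-firing on the infinite rooted binary tree (every vertex has a left and a right child) with a self-loop at the root; the root is on layer $1$ and children of a layer-$k$ vertex are on layer $k+1$. Start with $N$ indistinguishable chips at the root. A vertex with at least $3$ chips may fire, sending one chip to each child and one to its parent (the root keeps that chip via its self-loop). The process reaches a unique stable configuration (no vertex with $\ge3$ chips), and the number of times each vertex fires is independent of the order of fires; all vertices on the same layer fire the same number of times. $f_i(N)$ denotes the number of times each vertex on layer $i+1$ fires. Write $N+1$ in binary as $a_na_{n-1}\dots a_1a_0$ (so $a_n=1$) and set $c_i(N)=a_i+1$ for $0\le i\le n-1$; $c_i(N)$ is the number of chips on each vertex of layer $i+1$ in the stable configuration (layers below $n$ are empty). -}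

module Defs where

open import Data.Nat using (ℕ; zero; suc; _+_; _*_; _∸_; _^_; _<_; _≤_)
open import Data.Nat.DivMod using (_/_; _%_)
open import Data.Nat.Logarithm using (⌊log₂_⌋)
open import Data.Bool using (Bool; true; false; if_then_else_)
open import Data.List using (List; []; _∷_; length; filter)
open import Data.List.Properties using (≡-dec)
open import Relation.Nullary using (does)
open import Relation.Binary.PropositionalEquality using (_≡_)
import Data.Bool.Properties as BoolP

-- A vertex of the infinite rooted binary tree is the path from the root,
-- written with the MOST RECENT step first: [] is the root, the children of v
-- are (false ∷ v) (left) and (true ∷ v) (right), and the parent of (b ∷ v) is v.
-- A vertex v lies on layer (length v + 1).
Vertex : Set
Vertex = List Bool

_≟V_ : (u v : Vertex) → Relation.Nullary.Dec (u ≡ v)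
_≟V_ = ≡-dec BoolP._≟_

isChild : Vertex → Vertex → Bool
isChild []      v = false
isChild (b ∷ u) v = does (u ≟V v)

isRoot : Vertex → Bool
isRoot []      = true
isRoot (_ ∷ _) = false

one? : Bool → ℕ
one? true  = 1
one? false = 0

-- chips received by vertex u when vertex v fires:
-- one for each child of v, one for the parent of v, and one for the root via
-- its self-loop when the root fires.
gain : (v u : Vertex) → ℕ
gain v u = one? (isChild u v) + one? (isChild v u)
         + one? (isRoot v Data.Bool.∧ isRoot u)

Config : Set
Config = Vertex → ℕ

fire : Vertex → Config → Config
fire v σ u = if does (u ≟V v) then (σ u + gain v u) ∸ 3 else σ u + gain v u

data Run : Config → List Vertex → Config → Set where
  done : ∀ {σ} → Run σ [] σ
  step : ∀ {σ τ} v {s} → 3 ≤ σ v → Run (fire v σ) s τ → Run σ (v ∷ s) τ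

Stable : Config → Set
Stable σ = ∀ u → σ u < 3

initial : ℕ → Config
initial N []      = N
initial N (_ ∷ _) = 0

timesFired : Vertex → List Vertex → ℕ
timesFired v s = length (filter (λ u → u ≟V v) s)

digit : ℕ → ℕ → ℕ
digit m zero    = m % 2
digit m (suc i) = digit (m / 2) i

bit : ℕ → ℕ → ℕ
bit N i = digit (suc N) i

c : ℕ → ℕ → ℕ
c N i = bit N i + 1

nOf : ℕ → ℕ
nOf N = ⌊log₂ suc N ⌋

-- sumFromTo a b f = Σ_{j=a}^{b} f j  (empty, i.e. 0, when b < a)
sumFromTo : ℕ → ℕ → (ℕ → ℕ) → ℕ
sumFromTo a b f = go a (suc b ∸ a)
  where
  go : ℕ → ℕ → ℕ
  go j zero    = 0
  go j (suc k) = f j + go (suc j) k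

module Submission where

-- The odometer of a legal run to a stable configuration is the least function G such that firing
-- every vertex v G v times from the start leaves a stable configuration (least action). Tree
-- automorphisms preserve this property, so the odometer is constant on layers, f_k on layer k + 1.
-- Balance on layer k + 1 gives N + 2^{k+1} f_{k+1} = Σ_{j≤k} 2^j t_j + 2^{k+1} f_k for the final
-- layer contents t_j ≤ 2. Writing N = Σ_{j<n} 2^j c_j yields an explicit layer-constant solution
-- with final layers c_j ≥ 1, which dominates the odometer and vanishes from layer n on. Descending
-- from there, the invariant forces the two odometers to agree, because a string of digits ≤ 2 is
-- worth less than a string of digits ≥ 1 plus 2^{k+1}. For the explicit solution f_i - f_{i+1} is
-- by construction the number with binary digits c_{i+1}, …, c_{n-1}.

open import Defs
open import Data.Bool using (Bool; true; false; _xor_; if_then_else_)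
open import Data.Bool.Properties using (xor-assoc; xor-same)
open import Data.List using (List; []; _∷_; length; replicate)
open import Data.List.Properties using (length-replicate)
open import Data.Nat
  using (ℕ; zero; suc; _+_; _*_; _∸_; _^_; _≤_; _<_; _≤′_; ≤′-refl; ≤′-step; z≤n; s≤s; z<s; s<s; _≟_; _<?_; _≤?_; ⌊_/2⌋)
open import Data.Nat.DivMod using (_/_; _%_; m≡m%n+[m/n]*n; m%n<n; m/n<m; m≥n⇒m/n>0; m/n≡1+[m∸n]/n)
open import Data.Nat.Induction using (<-rec)
open import Data.Nat.Logarithm using (⌊log₂_⌋; ⌊log₂⌊n/2⌋⌋≡⌊log₂n⌋∸1; ⌊log₂⌋-mono-≤)
open import Data.Nat.Properties
open import Algebra.Properties.CommutativeSemigroup +-commutativeSemigroup using (xy∙z≈xz∙y)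
open import Data.Nat.Tactic.RingSolver using (solve-∀)
open import Data.Product using (_,_)
open import Function using (_∘_)
open import Relation.Nullary using (does; yes; no; contradiction)
open import Relation.Nullary.Decidable using (dec-true; dec-false)
open import Relation.Binary.PropositionalEquality

horner : ℕ → ℕ → (ℕ → ℕ) → ℕ
horner w zero    g = 0
horner w (suc m) g = g 0 + w * horner w m (g ∘ suc)

horner-cong : ∀ w m {g g′ : ℕ → ℕ} → (∀ j → j < m → g j ≡ g′ j) → horner w m g ≡ horner w m g′
horner-cong w zero    eq = refl
horner-cong w (suc m) eq =
  cong₂ (λ a b → a + w * b) (eq 0 z<s) (horner-cong w m (λ j j<m → eq (suc j) (s<s j<m)))

horner-mono : ∀ w m {g g′ : ℕ → ℕ} → (∀ j → j < m → g j ≤ g′ j) → horner w m g ≤ horner w m g′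
horner-mono w zero    le = z≤n
horner-mono w (suc m) le =
  +-mono-≤ (le 0 z<s) (*-monoʳ-≤ w (horner-mono w m (λ j j<m → le (suc j) (s<s j<m))))

horner-scale : ∀ w m a g → horner w m (λ j → a * g j) ≡ a * horner w m g
horner-scale w zero    a g = sym (*-zeroʳ a)
horner-scale w (suc m) a g = begin
  a * g 0 + w * horner w m (λ j → a * g (suc j)) ≡⟨ cong (λ x → a * g 0 + w * x) (horner-scale w m a (g ∘ suc)) ⟩
  a * g 0 + w * (a * horner w m (g ∘ suc))       ≡⟨ factor (g 0) w a _ ⟩
  a * (g 0 + w * horner w m (g ∘ suc))           ∎
  where
  open ≡-Reasoning
  factor : ∀ x w a h → a * x + w * (a * h) ≡ a * (x + w * h)
  factor = solve-∀

horner-snoc : ∀ w m g → horner w (suc m) g ≡ horner w m g + w ^ m * g m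
horner-snoc w zero    g = cong (g 0 +_) (*-zeroʳ w)
horner-snoc w (suc m) g = begin
  g 0 + w * horner w (suc m) (g ∘ suc)                 ≡⟨ cong (λ x → g 0 + w * x) (horner-snoc w m (g ∘ suc)) ⟩
  g 0 + w * (horner w m (g ∘ suc) + w ^ m * g (suc m)) ≡⟨ distrib (g 0) w _ (w ^ m) (g (suc m)) ⟩
  horner w (suc m) g + w ^ suc m * g (suc m)           ∎
  where
  open ≡-Reasoning
  distrib : ∀ a w h p x → a + w * (h + p * x) ≡ (a + w * h) + w * p * x
  distrib = solve-∀

horner-vanishing : ∀ w g {m m′} → m ≤ m′ → (∀ j → m ≤ j → g j ≡ 0) → horner w m′ g ≡ horner w m g
horner-vanishing w g {m} m≤m′ vanish = go (≤⇒≤′ m≤m′)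
  where
  go : ∀ {k} → m ≤′ k → horner w k g ≡ horner w m g
  go ≤′-refl              = refl
  go (≤′-step {k} m≤′k) = begin
    horner w (suc k) g         ≡⟨ horner-snoc w k g ⟩
    horner w k g + w ^ k * g k ≡⟨ cong (λ x → horner w k g + w ^ k * x) (vanish k (≤′⇒≤ m≤′k)) ⟩
    horner w k g + w ^ k * 0   ≡⟨ cong (horner w k g +_) (*-zeroʳ (w ^ k)) ⟩
    horner w k g + 0           ≡⟨ +-identityʳ _ ⟩
    horner w k g               ≡⟨ go m≤′k ⟩
    horner w m g               ∎
    where open ≡-Reasoning

horner-unroll : ∀ w n g a → (∀ j → n ≤ j → g (a + j) ≡ 0) →
  horner w n (λ j → g (a + j)) ≡ g a + w * horner w n (λ j → g (suc a + j))
horner-unroll w n g a vanish = begin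
  horner w n (λ j → g (a + j))                       ≡⟨ horner-vanishing w _ (n≤1+n n) vanish ⟨
  g (a + 0) + w * horner w n (λ j → g (a + suc j))   ≡⟨ cong₂ (λ x y → g x + w * y) (+-identityʳ a)
                                                          (horner-cong w n (λ j _ → cong g (+-suc a j))) ⟩
  g a + w * horner w n (λ j → g (suc a + j))         ∎
  where open ≡-Reasoning

horner-powers : ∀ w m g → horner w m g ≡ horner 1 m (λ j → w ^ j * g j)
horner-powers w zero    g = refl
horner-powers w (suc m) g = begin
  g 0 + w * horner w m (g ∘ suc)                      ≡⟨ cong (λ x → g 0 + w * x) (horner-powers w m (g ∘ suc)) ⟩
  g 0 + w * horner 1 m (λ j → w ^ j * g (suc j))      ≡⟨ cong (g 0 +_) (horner-scale 1 m w _) ⟨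
  g 0 + horner 1 m (λ j → w * (w ^ j * g (suc j)))    ≡⟨ cong₂ _+_ (*-identityˡ (g 0))
                                                           (horner-cong 1 m (λ j _ → *-assoc w (w ^ j) (g (suc j)))) ⟨
  1 * g 0 + horner 1 m (λ j → w ^ suc j * g (suc j))  ≡⟨ cong (1 * g 0 +_) (*-identityˡ _) ⟨
  horner 1 (suc m) (λ j → w ^ j * g j)                ∎
  where open ≡-Reasoning

suc-horner-ones : ∀ m → suc (horner 2 m (λ _ → 1)) ≡ 2 ^ m
suc-horner-ones zero    = refl
suc-horner-ones (suc m) = trans (double-suc (horner 2 m (λ _ → 1))) (cong (2 *_) (suc-horner-ones m))
  where
  double-suc : ∀ h → suc (1 + 2 * h) ≡ 2 * suc h
  double-suc = solve-∀

-- The left value is at most 2 (2^m - 1), the right one at least 2^m - 1.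
horner-gap : ∀ m {t t′ : ℕ → ℕ} → (∀ j → j < m → t j ≤ 2) → (∀ j → j < m → 1 ≤ t′ j) →
  horner 2 m t < horner 2 m t′ + 2 ^ m
horner-gap m {t} {t′} t≤2 1≤t′ = begin-strict
  horner 2 m t            ≤⟨ horner-mono 2 m t≤2 ⟩
  horner 2 m (λ _ → 2)    ≡⟨ horner-scale 2 m 2 (λ _ → 1) ⟩
  ones + (ones + 0)       <⟨ +-monoʳ-< ones (+-monoˡ-< 0 (n<1+n ones)) ⟩
  ones + (suc ones + 0)   ≡⟨ cong (ones +_) (+-identityʳ _) ⟩
  ones + suc ones         ≤⟨ +-mono-≤ (horner-mono 2 m 1≤t′) (≤-reflexive (suc-horner-ones m)) ⟩
  horner 2 m t′ + 2 ^ m   ∎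
  where
  open ≤-Reasoning
  ones = horner 2 m (λ _ → 1)

cancel-place : ∀ {A A′ P x y} → x ≤ y → A < A′ + P → A + P * x ≡ A′ + P * y → x ≡ y
cancel-place {A} {A′} {P} {x} x≤y A<A′+P eq with m≤n⇒∃[o]m+o≡n x≤y
... | zero  , refl = sym (+-identityʳ x)
... | suc d , refl = contradiction A<A′+P (≤⇒≯ (begin
  A′ + P                ≤⟨ +-monoʳ-≤ A′ (m≤m*n P (suc d)) ⟩
  A′ + P * suc d        ≡⟨ +-cancelʳ-≡ (P * x) _ _ (trans (regroup A′ P x (suc d)) (sym eq)) ⟩
  A                     ∎))
  where
  open ≤-Reasoning
  regroup : ∀ a p x e → (a + p * e) + p * x ≡ a + p * (x + e)
  regroup = solve-∀

≟V-sym : ∀ u v → does (u ≟V v) ≡ does (v ≟V u)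
≟V-sym u v with u ≟V v
... | yes u≡v = sym (dec-true (v ≟V u) (sym u≡v))
... | no  u≢v = sym (dec-false (v ≟V u) (u≢v ∘ sym))

δ : Vertex → Config
δ v u = one? (does (v ≟V u))

δ-≤ : ∀ {G : Config} v u → 1 ≤ G v → δ v u ≤ G u
δ-≤ v u 1≤Gv with v ≟V u
... | yes refl = 1≤Gv
... | no  _    = z≤n

firings : List Vertex → Config
firings s u = timesFired u s

firings-∷ : ∀ v s u → firings (v ∷ s) u ≡ δ v u + firings s u
firings-∷ v s u with does (v ≟V u)
... | true  = refl
... | false = refl

-- Chips received by u when every vertex w fires G w times (the root's self-loop included).
inflow : Config → Config
inflow G []      = G [] + G (false ∷ []) + G (true ∷ [])
inflow G (b ∷ p) = G p + G (false ∷ b ∷ p) + G (true ∷ b ∷ p)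

inflow-cong : ∀ {G H : Config} → (∀ w → G w ≡ H w) → ∀ u → inflow G u ≡ inflow H u
inflow-cong eq []      = cong₂ _+_ (cong₂ _+_ (eq _) (eq _)) (eq _)
inflow-cong eq (_ ∷ _) = cong₂ _+_ (cong₂ _+_ (eq _) (eq _)) (eq _)

+-interchange₃ : ∀ a b c d e f → (a + d) + (b + e) + (c + f) ≡ (a + b + c) + (d + e + f)
+-interchange₃ = solve-∀

inflow-+ : ∀ G H u → inflow (λ w → G w + H w) u ≡ inflow G u + inflow H u
inflow-+ G H []      =
  +-interchange₃ (G []) (G (false ∷ [])) (G (true ∷ [])) (H []) (H (false ∷ [])) (H (true ∷ []))
inflow-+ G H (b ∷ p) =
  +-interchange₃ (G p) (G (false ∷ b ∷ p)) (G (true ∷ b ∷ p)) (H p) (H (false ∷ b ∷ p)) (H (true ∷ b ∷ p))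

inflow-δ : ∀ v u → inflow (δ v) u ≡ gain v u
inflow-δ []              []      = refl
inflow-δ (true  ∷ [])    []      = refl
inflow-δ (false ∷ [])    []      = refl
inflow-δ (true  ∷ _ ∷ _) []      = refl
inflow-δ (false ∷ _ ∷ _) []      = refl
inflow-δ []              (b ∷ p) = cong (λ x → one? x + 0 + 0) (≟V-sym [] p)
inflow-δ (true  ∷ q)     (b ∷ p) = trans (xy∙z≈xz∙y (one? (does ((true ∷ q) ≟V p))) 0 _)
                                     (cong (λ x → one? x + one? (does (q ≟V (b ∷ p))) + 0) (≟V-sym (true ∷ q) p))
inflow-δ (false ∷ q)     (b ∷ p) = cong (λ x → one? x + one? (does (q ≟V (b ∷ p))) + 0) (≟V-sym (false ∷ q) p)

-- Odometers and least action

-- Firing every vertex w exactly G w times, in any order and ignoring legality, takes σ to τ.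
Balanced : Config → Config → Config → Set
Balanced σ τ G = ∀ u → τ u + 3 * G u ≡ σ u + inflow G u

-- Firing every vertex w exactly G w times from σ, ignoring legality, ends in a stable configuration.
Stabilizing : Config → Config → Set
Stabilizing σ G = ∀ u → σ u + inflow G u < 3 + 3 * G u

Balanced-cong : ∀ {σ τ G H} → (∀ u → G u ≡ H u) → Balanced σ τ G → Balanced σ τ H
Balanced-cong {σ} {τ} G≗H B u =
  trans (cong (λ x → τ u + 3 * x) (sym (G≗H u))) (trans (B u) (cong (σ u +_) (inflow-cong G≗H u)))

Balanced-compose : ∀ {σ ρ τ G H} → Balanced σ ρ G → Balanced ρ τ H → Balanced σ τ (λ u → G u + H u)
Balanced-compose {σ} {ρ} {τ} {G} {H} Bσρ Bρτ u = begin
  τ u + 3 * (G u + H u)             ≡⟨ split (τ u) (G u) (H u) ⟩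
  (τ u + 3 * H u) + 3 * G u         ≡⟨ cong (_+ 3 * G u) (Bρτ u) ⟩
  (ρ u + inflow H u) + 3 * G u      ≡⟨ xy∙z≈xz∙y (ρ u) (inflow H u) (3 * G u) ⟩
  (ρ u + 3 * G u) + inflow H u      ≡⟨ cong (_+ inflow H u) (Bσρ u) ⟩
  (σ u + inflow G u) + inflow H u   ≡⟨ +-assoc (σ u) _ _ ⟩
  σ u + (inflow G u + inflow H u)   ≡⟨ cong (σ u +_) (inflow-+ G H u) ⟨
  σ u + inflow (λ w → G w + H w) u  ∎
  where
  open ≡-Reasoning
  split : ∀ t g h → t + 3 * (g + h) ≡ (t + 3 * h) + 3 * g
  split = solve-∀

fire-balanced : ∀ {σ v} → 3 ≤ σ v → Balanced σ (fire v σ) (δ v)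
fire-balanced {σ} {v} 3≤σv u rewrite inflow-δ v u with u ≟V v
... | yes refl rewrite dec-true (u ≟V u) refl = m∸n+n≡m (≤-trans 3≤σv (m≤m+n (σ u) (gain u u)))
... | no  u≢v  rewrite dec-false (v ≟V u) (u≢v ∘ sym) = +-identityʳ _

Run-balanced : ∀ {σ s τ} → Run σ s τ → Balanced σ τ (firings s)
Run-balanced done []      = refl
Run-balanced done (_ ∷ _) = refl
Run-balanced {σ} {v ∷ s} {τ} (step v 3≤σv run) =
  Balanced-cong {σ} {τ} (λ u → sym (firings-∷ v s u))
    (Balanced-compose {σ} {fire v σ} {τ} (fire-balanced 3≤σv) (Run-balanced run))

Balanced⇒Stabilizing : ∀ {σ τ G} → Balanced σ τ G → Stable τ → Stabilizing σ G
Balanced⇒Stabilizing {G = G} B stable u = subst (_< 3 + 3 * G u) (B u) (+-monoˡ-< (3 * G u) (stable u))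

-- What remains of a stabilizing odometer after part of it has been carried out.
Stabilizing-residual : ∀ {σ ρ G H K} → Balanced σ ρ H → (∀ u → H u + K u ≡ G u) →
  Stabilizing σ G → Stabilizing ρ K
Stabilizing-residual {σ} {ρ} {G} {H} {K} B H+K≗G S u =
  +-cancelʳ-< (3 * H u) _ _ (subst₂ _<_ before after (S u))
  where
  open ≡-Reasoning
  before : σ u + inflow G u ≡ (ρ u + inflow K u) + 3 * H u
  before = begin
    σ u + inflow G u                       ≡⟨ cong (σ u +_) (inflow-cong H+K≗G u) ⟨
    σ u + inflow (λ w → H w + K w) u       ≡⟨ cong (σ u +_) (inflow-+ H K u) ⟩
    σ u + (inflow H u + inflow K u)        ≡⟨ +-assoc (σ u) _ _ ⟨
    (σ u + inflow H u) + inflow K u        ≡⟨ cong (_+ inflow K u) (B u) ⟨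
    (ρ u + 3 * H u) + inflow K u           ≡⟨ xy∙z≈xz∙y (ρ u) _ _ ⟩
    (ρ u + inflow K u) + 3 * H u           ∎
  after : 3 + 3 * G u ≡ (3 + 3 * K u) + 3 * H u
  after = begin
    3 + 3 * G u                ≡⟨ cong (λ x → 3 + 3 * x) (H+K≗G u) ⟨
    3 + 3 * (H u + K u)        ≡⟨ split (H u) (K u) ⟩
    (3 + 3 * K u) + 3 * H u    ∎
    where
    split : ∀ h k → 3 + 3 * (h + k) ≡ (3 + 3 * k) + 3 * h
    split = solve-∀

least-action : ∀ {σ s τ G} → Run σ s τ → Stabilizing σ G → ∀ u → firings s u ≤ G u
least-action done _ u = z≤n
least-action {σ} {v ∷ s} {G = G} (step v 3≤σv run) S u = begin
  firings (v ∷ s) u             ≡⟨ firings-∷ v s u ⟩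
  δ v u + firings s u           ≤⟨ +-monoʳ-≤ (δ v u) (least-action run residual u) ⟩
  δ v u + (G u ∸ δ v u)         ≡⟨ m+[n∸m]≡n (δ-≤ v u 1≤Gv) ⟩
  G u                           ∎
  where
  open ≤-Reasoning
  1≤Gv : 1 ≤ G v
  1≤Gv with G v in eq
  ... | suc _ = s≤s z≤n
  ... | zero  = contradiction (subst (λ g → σ v + inflow G v < 3 + 3 * g) eq (S v))
                              (≤⇒≯ (≤-trans 3≤σv (m≤m+n (σ v) (inflow G v))))
  residual : Stabilizing (fire v σ) (λ w → G w ∸ δ v w)
  residual = Stabilizing-residual (fire-balanced 3≤σv) (λ w → m+[n∸m]≡n (δ-≤ v w 1≤Gv)) S

-- Symmetry of the tree

-- The automorphism exchanging the two subtrees below every vertex at each depth k with g k.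
mirror : (ℕ → Bool) → Vertex → Vertex
mirror g []      = []
mirror g (b ∷ p) = (b xor g (length p)) ∷ mirror g p

mirror-inflow : ∀ G g u → inflow (G ∘ mirror g) u ≡ inflow G (mirror g u)
mirror-inflow G g [] with g 0
... | false = refl
... | true  = xy∙z≈xz∙y (G []) _ _
mirror-inflow G g (b ∷ p) with g (suc (length p))
... | false = refl
... | true  = xy∙z≈xz∙y (G (mirror g p)) _ _

mirror-initial : ∀ N g u → initial N (mirror g u) ≡ initial N u
mirror-initial N g []      = refl
mirror-initial N g (_ ∷ _) = refl

Stabilizing-mirror : ∀ {σ G} g → (∀ u → σ (mirror g u) ≡ σ u) → Stabilizing σ G → Stabilizing σ (G ∘ mirror g)
Stabilizing-mirror {σ} {G} g σ-invariant S u =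
  subst (_< 3 + 3 * G (mirror g u)) (cong₂ _+_ (σ-invariant u) (sym (mirror-inflow G g u))) (S (mirror g u))

mirror-agree : ∀ {g g′} p → (∀ k → k < length p → g k ≡ g′ k) → mirror g p ≡ mirror g′ p
mirror-agree []      agree = refl
mirror-agree (b ∷ p) agree =
  cong₂ _∷_ (cong (b xor_) (agree (length p) ≤-refl)) (mirror-agree p (λ k k<p → agree k (m<n⇒m<1+n k<p)))

-- The depths at which the vertices u and v branch differently.
mirrorTo : Vertex → Vertex → ℕ → Bool
mirrorTo (a ∷ p) (b ∷ q) k = if does (k ≟ length p) then a xor b else mirrorTo p q k
mirrorTo _       _       k = false

mirror-mirrorTo : ∀ u v → length u ≡ length v → mirror (mirrorTo u v) u ≡ v
mirror-mirrorTo []      []      _  = refl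
mirror-mirrorTo (a ∷ p) (b ∷ q) eq = cong₂ _∷_ head (trans (mirror-agree p below) (mirror-mirrorTo p q (suc-injective eq)))
  where
  head : a xor mirrorTo (a ∷ p) (b ∷ q) (length p) ≡ b
  head rewrite dec-true (length p ≟ length p) refl =
    trans (sym (xor-assoc a a b)) (cong (_xor b) (xor-same a))
  below : ∀ k → k < length p → mirrorTo (a ∷ p) (b ∷ q) k ≡ mirrorTo p q k
  below k k<p rewrite dec-false (k ≟ length p) (<⇒≢ k<p) = refl

firings-layerwise : ∀ {σ s τ} → Run σ s τ → Stable τ → (∀ g u → σ (mirror g u) ≡ σ u) →
  ∀ u v → length u ≡ length v → firings s u ≡ firings s v
firings-layerwise {s = s} run stable σ-invariant u v eq = ≤-antisym (bound u v eq) (bound v u (sym eq))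
  where
  bound : ∀ u v → length u ≡ length v → firings s u ≤ firings s v
  bound u v eq = subst (firings s u ≤_) (cong (firings s) (mirror-mirrorTo u v eq))
    (least-action run (Stabilizing-mirror (mirrorTo u v) (σ-invariant _)
                         (Balanced⇒Stabilizing (Run-balanced run) stable)) u)

-- Layer equations

onLayer : (ℕ → ℕ) → Config
onLayer h u = h (length u)

leftmost : ℕ → Vertex
leftmost k = replicate k false

-- Balanced (initial N) (onLayer t) (onLayer h) written out; layer k here is the paper's layer k + 1.
record LayerBalanced (N : ℕ) (t h : ℕ → ℕ) : Set where
  field
    at-root    : t 0 + 3 * h 0 ≡ N + (h 0 + h 1 + h 1)
    below-root : ∀ k → t (suc k) + 3 * h (suc k) ≡ h k + h (suc (suc k)) + h (suc (suc k))

LayerBalanced⇒Balanced : ∀ {N t h} → LayerBalanced N t h → Balanced (initial N) (onLayer t) (onLayer h)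
LayerBalanced⇒Balanced B []      = LayerBalanced.at-root B
LayerBalanced⇒Balanced B (_ ∷ p) = LayerBalanced.below-root B (length p)

Balanced⇒LayerBalanced : ∀ {N τ h} → Balanced (initial N) τ (onLayer h) → LayerBalanced N (τ ∘ leftmost) h
Balanced⇒LayerBalanced {N} {τ} {h} B = record
  { at-root    = B []
  ; below-root = λ k → subst (λ m → τ (leftmost (suc k)) + 3 * h (suc m) ≡ h m + h (suc (suc m)) + h (suc (suc m)))
                             (length-replicate k) (B (false ∷ leftmost k))
  }

-- Σ_{j≤k} 2^j t_j = N - 2^{k+1} (h_k - h_{k+1}), with both sides moved so that no subtraction occurs.
layer-invariant : ∀ {N t h} → LayerBalanced N t h →
  ∀ k → N + 2 ^ suc k * h (suc k) ≡ horner 2 (suc k) t + 2 ^ suc k * h k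
layer-invariant {N} {t} {h} B zero = +-cancelʳ-≡ (h 0) _ _ (begin
  (N + 2 * h 1) + h 0             ≡⟨ regroup N (h 0) (h 1) ⟩
  N + (h 0 + h 1 + h 1)           ≡⟨ LayerBalanced.at-root B ⟨
  t 0 + 3 * h 0                   ≡⟨ split (t 0) (h 0) ⟩
  (t 0 + 2 * 0 + 2 * h 0) + h 0   ∎)
  where
  open ≡-Reasoning
  regroup : ∀ n a b → (n + 2 * b) + a ≡ n + (a + b + b)
  regroup = solve-∀
  split : ∀ x a → x + 3 * a ≡ (x + 2 * 0 + 2 * a) + a
  split = solve-∀
layer-invariant {N} {t} {h} B (suc k) = +-cancelʳ-≡ (P * h k) _ _ (begin
  (N + 2 * P * h₂) + P * h k                     ≡⟨ gather N P (h k) h₂ ⟩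
  N + P * (h k + h₂ + h₂)                        ≡⟨ cong (λ x → N + P * x) (LayerBalanced.below-root B k) ⟨
  N + P * (t (suc k) + 3 * h₁)                   ≡⟨ spread N P (t (suc k)) h₁ ⟩
  (N + P * h₁) + (P * t (suc k) + 2 * P * h₁)    ≡⟨ cong (_+ (P * t (suc k) + 2 * P * h₁)) (layer-invariant B k) ⟩
  (A + P * h k) + (P * t (suc k) + 2 * P * h₁)   ≡⟨ swap A P (h k) (t (suc k)) h₁ ⟩
  (A + P * t (suc k) + 2 * P * h₁) + P * h k     ≡⟨ cong (λ x → x + 2 * P * h₁ + P * h k) (horner-snoc 2 (suc k) t) ⟨
  (horner 2 (suc (suc k)) t + 2 * P * h₁) + P * h k ∎)
  where
  open ≡-Reasoning
  P  = 2 ^ suc k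
  A  = horner 2 (suc k) t
  h₁ = h (suc k)
  h₂ = h (suc (suc k))
  gather : ∀ n p a c → (n + 2 * p * c) + p * a ≡ n + p * (a + c + c)
  gather = solve-∀
  spread : ∀ n p x b → n + p * (x + 3 * b) ≡ (n + p * b) + (p * x + 2 * p * b)
  spread = solve-∀
  swap : ∀ a p h x b → (a + p * h) + (p * x + 2 * p * b) ≡ (a + p * x + 2 * p * b) + p * h
  swap = solve-∀

-- Two layer solutions whose final layers have digits ≤ 2, resp. ≥ 1 below layer n, agree once the
-- larger odometer vanishes from layer n - 1 on: descend from there with the layer invariant.
layer-odometers-agree : ∀ {N t h t′ h′} n → LayerBalanced N t h → LayerBalanced N t′ h′ →
  (∀ j → t j ≤ 2) → (∀ j → j < n → 1 ≤ t′ j) →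
  (∀ k → h k ≤ h′ k) → (∀ k → n ≤ suc k → h′ k ≡ 0) →
  ∀ k → h k ≡ h′ k
layer-odometers-agree {N} {t} {h} {t′} {h′} n B B′ t≤2 1≤t′ h≤h′ h′-vanishes k =
  descend n k (≤-trans (m≤m+n n k) (n≤1+n (n + k)))
  where
  descend-step : ∀ k → k < n → h (suc k) ≡ h′ (suc k) → h k ≡ h′ k
  descend-step k k<n eq = cancel-place {A′ = horner 2 (suc k) t′} {P = 2 ^ suc k} (h≤h′ k)
    (horner-gap (suc k) (λ j _ → t≤2 j) (λ j j≤k → 1≤t′ j (≤-<-trans (≤-pred j≤k) k<n)))
    (trans (sym (layer-invariant B k)) (trans (cong (λ x → N + 2 ^ suc k * x) eq) (layer-invariant B′ k)))
  descend : ∀ d k → n ≤ suc (d + k) → h k ≡ h′ k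
  descend d k _ with n ≤? suc k
  ... | yes n≤1+k = trans (n≤0⇒n≡0 (subst (h k ≤_) (h′-vanishes k n≤1+k) (h≤h′ k))) (sym (h′-vanishes k n≤1+k))
  descend zero    k n≤1+k | no n≰1+k = contradiction n≤1+k n≰1+k
  descend (suc d) k n≤2+d+k | no n≰1+k =
    descend-step k (<-trans (n<1+n k) (≰⇒> n≰1+k)) (descend d (suc k) (subst (λ x → n ≤ suc x) (sym (+-suc d k)) n≤2+d+k))

module DigitOdometer (t : ℕ → ℕ) (n : ℕ) (t-vanishes : ∀ j → n ≤ j → t j ≡ 0) where

  above : ℕ → ℕ
  above k = horner 2 n (λ j → t (suc k + j))

  odometer : ℕ → ℕ
  odometer k = horner 1 n (λ j → above (k + j))

  above-vanishes : ∀ k → n ≤ suc k → above k ≡ 0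
  above-vanishes k n≤1+k = horner-vanishing 2 _ (z≤n {n}) (λ j _ → t-vanishes (suc k + j) (≤-trans n≤1+k (m≤m+n (suc k) j)))

  above-step : ∀ k → above k ≡ t (suc k) + 2 * above (suc k)
  above-step k = horner-unroll 2 n t (suc k) (λ j n≤j → t-vanishes (suc k + j) (≤-trans n≤j (m≤n+m j (suc k))))

  odometer-vanishes : ∀ k → n ≤ suc k → odometer k ≡ 0
  odometer-vanishes k n≤1+k = horner-vanishing 1 _ (z≤n {n}) (λ j _ → above-vanishes (k + j) (≤-trans n≤1+k (s≤s (m≤m+n k j))))

  odometer-step : ∀ k → odometer k ≡ above k + odometer (suc k)
  odometer-step k = trans (horner-unroll 1 n above k (λ j n≤j → above-vanishes (k + j) (≤-trans n≤j (m≤n+m j (suc k)))))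
                          (cong (above k +_) (*-identityˡ _))

  layerBalanced : ∀ {N} → horner 2 n t ≡ N → LayerBalanced N t odometer
  layerBalanced {N} value = record { at-root = at-root ; below-root = below-root }
    where
    open ≡-Reasoning
    N-split : N ≡ t 0 + 2 * above 0
    N-split = trans (sym value) (horner-unroll 2 n t 0 (λ j n≤j → t-vanishes j n≤j))
    at-root : t 0 + 3 * odometer 0 ≡ N + (odometer 0 + odometer 1 + odometer 1)
    at-root = begin
      t 0 + 3 * odometer 0                                  ≡⟨ cong (λ x → t 0 + 3 * x) (odometer-step 0) ⟩
      t 0 + 3 * (above 0 + odometer 1)                      ≡⟨ regroup (t 0) (above 0) (odometer 1) ⟩
      (t 0 + 2 * above 0) + (above 0 + odometer 1 + odometer 1 + odometer 1)
        ≡⟨ cong₂ (λ x y → x + (y + odometer 1 + odometer 1)) (sym N-split) (sym (odometer-step 0)) ⟩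
      N + (odometer 0 + odometer 1 + odometer 1)            ∎
      where
      regroup : ∀ x a h → x + 3 * (a + h) ≡ (x + 2 * a) + (a + h + h + h)
      regroup = solve-∀
    below-root : ∀ k → t (suc k) + 3 * odometer (suc k) ≡ odometer k + odometer (suc (suc k)) + odometer (suc (suc k))
    below-root k = begin
      t (suc k) + 3 * odometer (suc k)                      ≡⟨ cong (λ x → t (suc k) + 3 * x) (odometer-step (suc k)) ⟩
      t (suc k) + 3 * (above (suc k) + h₂)                  ≡⟨ regroup (t (suc k)) (above (suc k)) h₂ ⟩
      ((t (suc k) + 2 * above (suc k)) + (above (suc k) + h₂)) + h₂ + h₂
        ≡⟨ cong₂ (λ x y → x + y + h₂ + h₂) (sym (above-step k)) (sym (odometer-step (suc k))) ⟩
      (above k + odometer (suc k)) + h₂ + h₂                ≡⟨ cong (λ x → x + h₂ + h₂) (odometer-step k) ⟨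
      odometer k + h₂ + h₂                                  ∎
      where
      h₂ = odometer (suc (suc k))
      regroup : ∀ x a h → x + 3 * (a + h) ≡ ((x + 2 * a) + (a + h)) + h + h
      regroup = solve-∀

-- Binary expansion

digit≤1 : ∀ m i → digit m i ≤ 1
digit≤1 m zero    = ≤-pred (m%n<n m 2)
digit≤1 m (suc i) = digit≤1 (m / 2) i

⌊n/2⌋≡n/2 : ∀ n → ⌊ n /2⌋ ≡ n / 2
⌊n/2⌋≡n/2 zero          = refl
⌊n/2⌋≡n/2 (suc zero)    = refl
⌊n/2⌋≡n/2 (suc (suc n)) = trans (cong suc (⌊n/2⌋≡n/2 n)) (sym (m/n≡1+[m∸n]/n {suc (suc n)} {2} (s≤s (s≤s z≤n))))

⌊log₂⌋-halve : ∀ m → 2 ≤ m → ⌊log₂ m ⌋ ≡ suc ⌊log₂ (m / 2) ⌋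
⌊log₂⌋-halve m 2≤m = begin
  ⌊log₂ m ⌋                ≡⟨ m∸n+n≡m (⌊log₂⌋-mono-≤ 2≤m) ⟨
  ⌊log₂ m ⌋ ∸ 1 + 1        ≡⟨ +-comm _ 1 ⟩
  suc (⌊log₂ m ⌋ ∸ 1)      ≡⟨ cong suc (⌊log₂⌊n/2⌋⌋≡⌊log₂n⌋∸1 m) ⟨
  suc ⌊log₂ ⌊ m /2⌋ ⌋      ≡⟨ cong (λ x → suc ⌊log₂ x ⌋) (⌊n/2⌋≡n/2 m) ⟩
  suc ⌊log₂ (m / 2) ⌋      ∎
  where open ≡-Reasoning

-- m = 2^L + Σ_{j<L} 2^j digit m j with L = ⌊log₂ m⌋, and 2^L - 1 = Σ_{j<L} 2^j.
suc-horner-digits : ∀ m → 1 ≤ m → suc (horner 2 ⌊log₂ m ⌋ (λ j → digit m j + 1)) ≡ m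
suc-horner-digits = <-rec _ expand
  where
  open ≡-Reasoning
  expand : ∀ m → (∀ {k} → k < m → 1 ≤ k → suc (horner 2 ⌊log₂ k ⌋ (λ j → digit k j + 1)) ≡ k) →
           1 ≤ m → suc (horner 2 ⌊log₂ m ⌋ (λ j → digit m j + 1)) ≡ m
  expand (suc zero)        _  _ = refl
  expand m@(suc (suc k)) rec _ = begin
    suc (horner 2 ⌊log₂ m ⌋ (λ j → digit m j + 1))  ≡⟨ cong (λ L → suc (horner 2 L (λ j → digit m j + 1)))
                                                          (⌊log₂⌋-halve m 2≤m) ⟩
    suc ((m % 2 + 1) + 2 * S)                         ≡⟨ regroup (m % 2) S ⟩
    m % 2 + suc S * 2                                 ≡⟨ cong (λ x → m % 2 + x * 2) (rec (m/n<m m 2 (n<1+n 1)) (m≥n⇒m/n>0 2≤m)) ⟩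
    m % 2 + m / 2 * 2                                 ≡⟨ m≡m%n+[m/n]*n m 2 ⟨
    m                                                 ∎
    where
    2≤m : 2 ≤ m
    2≤m = s≤s (s≤s z≤n)
    S = horner 2 ⌊log₂ (m / 2) ⌋ (λ j → digit (m / 2) j + 1)
    regroup : ∀ r s → suc ((r + 1) + 2 * s) ≡ r + suc s * 2
    regroup = solve-∀

binary-expansion : ∀ N → horner 2 (nOf N) (c N) ≡ N
binary-expansion N = suc-injective (suc-horner-digits (suc N) (s≤s z≤n))

stableLayers : ℕ → ℕ → ℕ
stableLayers N j = if does (j <? nOf N) then c N j else 0

stableLayers-< : ∀ N j → j < nOf N → stableLayers N j ≡ c N j
stableLayers-< N j j<n rewrite dec-true (j <? nOf N) j<n = refl

stableLayers-vanishes : ∀ N j → nOf N ≤ j → stableLayers N j ≡ 0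
stableLayers-vanishes N j n≤j rewrite dec-false (j <? nOf N) (≤⇒≯ n≤j) = refl

stableLayers-≤2 : ∀ N j → stableLayers N j ≤ 2
stableLayers-≤2 N j with does (j <? nOf N)
... | true  = +-monoˡ-≤ 1 (digit≤1 (suc N) j)
... | false = z≤n

stableLayers-≥1 : ∀ N j → j < nOf N → 1 ≤ stableLayers N j
stableLayers-≥1 N j j<n = subst (1 ≤_) (sym (stableLayers-< N j j<n)) (m≤n+m 1 (bit N j))

stableLayers-value : ∀ N → horner 2 (nOf N) (stableLayers N) ≡ N
stableLayers-value N = trans (horner-cong 2 (nOf N) (stableLayers-< N)) (binary-expansion N)

module Explicit (N : ℕ) = DigitOdometer (stableLayers N) (nOf N) (stableLayers-vanishes N)

odometer-explicit : ∀ {N s τ} → Run (initial N) s τ → Stable τ → ∀ u → firings s u ≡ Explicit.odometer N (length u)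
odometer-explicit {N} {s} {τ} run stable u = trans (on-layer u) (agree (length u))
  where
  open Explicit N
  f : ℕ → ℕ
  f k = firings s (leftmost k)
  on-layer : ∀ u → firings s u ≡ f (length u)
  on-layer u = firings-layerwise run stable (mirror-initial N) u (leftmost (length u)) (sym (length-replicate (length u)))
  balanced : Balanced (initial N) τ (onLayer f)
  balanced = Balanced-cong {initial N} {τ} on-layer (Run-balanced run)
  explicit : LayerBalanced N (stableLayers N) odometer
  explicit = layerBalanced (stableLayers-value N)
  f≤odometer : ∀ k → f k ≤ odometer k
  f≤odometer k = subst (λ m → f k ≤ odometer m) (length-replicate k)
    (least-action run (Balanced⇒Stabilizing (LayerBalanced⇒Balanced explicit) (λ u → s≤s (stableLayers-≤2 N (length u))))
                  (leftmost k))
  agree : ∀ k → f k ≡ odometer k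
  agree = layer-odometers-agree (nOf N) (Balanced⇒LayerBalanced {N} {τ} {f} balanced) explicit
    (λ j → ≤-pred (stable (leftmost j))) (stableLayers-≥1 N) f≤odometer odometer-vanishes

sumFromTo-[] : ∀ a f → sumFromTo (suc a) a f ≡ 0
sumFromTo-[] a f rewrite n∸n≡0 a = refl

-- sumFromTo recurses through a local helper on suc b ∸ a, so it unfolds only once that is a successor.
sumFromTo-∷ : ∀ a m f → sumFromTo a (a + m) f ≡ f a + sumFromTo (suc a) (a + m) f
sumFromTo-∷ a m f = unfold (trans (cong (_∸ a) (sym (+-suc a m))) (m+n∸m≡n a (suc m))) (m+n∸m≡n a m)
  where
  unfold : ∀ {b k} → suc b ∸ a ≡ suc k → b ∸ a ≡ k → sumFromTo a b f ≡ f a + sumFromTo (suc a) b f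
  unfold eq eq′ rewrite eq | eq′ = refl

sumFromTo-horner : ∀ a m f → sumFromTo (suc a) (a + m) f ≡ horner 1 m (λ j → f (suc a + j))
sumFromTo-horner a zero    f = trans (cong (λ b → sumFromTo (suc a) b f) (+-identityʳ a)) (sumFromTo-[] a f)
sumFromTo-horner a (suc m) f = begin
  sumFromTo (suc a) (a + suc m) f                     ≡⟨ cong (λ b → sumFromTo (suc a) b f) (+-suc a m) ⟩
  sumFromTo (suc a) (suc a + m) f                     ≡⟨ sumFromTo-∷ (suc a) m f ⟩
  f (suc a) + sumFromTo (suc (suc a)) (suc a + m) f   ≡⟨ cong (f (suc a) +_) (sumFromTo-horner (suc a) m f) ⟩
  f (suc a) + horner 1 m (λ j → f (suc (suc a) + j))  ≡⟨ cong₂ _+_ (cong f (+-identityʳ (suc a))) (trans (*-identityˡ _)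
                                                           (horner-cong 1 m (λ j _ → cong f (+-suc (suc a) j)))) ⟨
  horner 1 (suc m) (λ j → f (suc a + j))              ∎
  where open ≡-Reasoning

above-sumFromTo : ∀ N i → i + 2 ≤ nOf N →
  Explicit.above N i ≡ sumFromTo (i + 1) (nOf N ∸ 1) (λ j → 2 ^ (j ∸ i ∸ 1) * c N j)
above-sumFromTo N i i+2≤n = begin
  horner 2 (nOf N) (λ j → stableLayers N (suc i + j))
    ≡⟨ horner-vanishing 2 _ 1+e≤n (λ j 1+e≤j → stableLayers-vanishes N _ (n≤1+i+ j 1+e≤j)) ⟩
  horner 2 (suc e) (λ j → stableLayers N (suc i + j))
    ≡⟨ horner-cong 2 (suc e) (λ j j<1+e → stableLayers-< N _ (1+i+<n j j<1+e)) ⟩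
  horner 2 (suc e) (λ j → c N (suc i + j))
    ≡⟨ horner-powers 2 (suc e) (λ j → c N (suc i + j)) ⟩
  horner 1 (suc e) (λ j → 2 ^ j * c N (suc i + j))
    ≡⟨ horner-cong 1 (suc e) (λ j _ → cong (λ x → 2 ^ (x ∸ 1) * c N (suc i + j)) (lift j)) ⟨
  horner 1 (suc e) (λ j → F (suc i + j))
    ≡⟨ sumFromTo-horner i (suc e) F ⟨
  sumFromTo (suc i) (i + suc e) F
    ≡⟨ cong₂ (λ a b → sumFromTo a b F) (+-comm 1 i) (cong (_∸ 1) n-split) ⟩
  sumFromTo (i + 1) (nOf N ∸ 1) F
    ∎
  where
  open ≡-Reasoning
  F : ℕ → ℕ
  F j = 2 ^ (j ∸ i ∸ 1) * c N j
  e = nOf N ∸ (i + 2)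
  n-split : suc i + suc e ≡ nOf N
  n-split = trans (shape i e) (m+[n∸m]≡n i+2≤n)
    where
    shape : ∀ i e → suc i + suc e ≡ i + 2 + e
    shape = solve-∀
  1+e≤n : suc e ≤ nOf N
  1+e≤n = subst (suc e ≤_) n-split (m≤n+m (suc e) (suc i))
  n≤1+i+ : ∀ j → suc e ≤ j → nOf N ≤ suc i + j
  n≤1+i+ j 1+e≤j = subst (_≤ suc i + j) n-split (+-monoʳ-≤ (suc i) 1+e≤j)
  1+i+<n : ∀ j → j < suc e → suc i + j < nOf N
  1+i+<n j j<1+e = subst (suc i + j <_) n-split (+-monoʳ-< (suc i) j<1+e)
  lift : ∀ j → suc i + j ∸ i ≡ suc j
  lift j = trans (cong (_∸ i) (sym (+-suc i j))) (m+n∸m≡n i (suc j))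

mainTheorem13 : (N : ℕ) → 1 ≤ N →
    (s : List Vertex) (τ : Config) → Run (initial N) s τ → Stable τ →
    (i : ℕ) → i + 2 ≤ nOf N →
    (v w : Vertex) → length v ≡ i → length w ≡ i + 1 →
    timesFired v s ≡ timesFired w s
      + sumFromTo (i + 1) (nOf N ∸ 1) (λ j → 2 ^ (j ∸ i ∸ 1) * c N j)
-- The hypothesis 1 ≤ N is implied by i + 2 ≤ nOf N.
mainTheorem13 N _ s τ run stable i i+2≤n v w ∣v∣≡i ∣w∣≡i+1 = begin
  timesFired v s                      ≡⟨ odometer-explicit run stable v ⟩
  odometer (length v)                 ≡⟨ cong odometer ∣v∣≡i ⟩
  odometer i                          ≡⟨ odometer-step i ⟩
  above i + odometer (suc i)          ≡⟨ +-comm (above i) _ ⟩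
  odometer (suc i) + above i          ≡⟨ cong₂ _+_ (cong odometer (trans (+-comm 1 i) (sym ∣w∣≡i+1)))
                                                   (above-sumFromTo N i i+2≤n) ⟩
  odometer (length w) + Σc            ≡⟨ cong (_+ Σc) (odometer-explicit run stable w) ⟨
  timesFired w s + Σc                 ∎
  where
  open ≡-Reasoning
  open Explicit N
  Σc = sumFromTo (i + 1) (nOf N ∸ 1) (λ j → 2 ^ (j ∸ i ∸ 1) * c N j)
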